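{- For every nGCL program $C$, $\mathsf{slp}[\![C]\!]$ is co-strict: $\mathsf{slp}[\![C]\!](+\infty)=+\infty$, where $+\infty$ denotes the constant quantity $\lambda\sigma.\,+\infty$.
   Context: Programs (nGCL) are generated by $C ::= \mathtt{skip} \mid x := e \mid C_1;C_2 \mid \mathtt{if}\,(\varphi)\,\{C_1\}\,\mathtt{else}\,\{C_2\} \mid \{C_1\}\,\square\,\{C_2\} \mid \mathtt{while}\,(\varphi)\,\{C\}$ ($\square$ is nondeterministic choice). A state $\sigma\in\Sigma$ maps each variable to a value in a fixed value domain $\mathbb{V}$; $\sigma(e)$ is the value of expression $e$, $\sigma\models\varphi$ means guard $\varphi$ holds, $\sigma[x\mapsto v]$ is the updated state. Quantities: $\mathbb{A}$ is the set of functions $\Sigma\to\mathbb{R}\cup\{ -\infty,+\infty\}$ ordered pointwise by $\preceq$; $\sqcap,\sqcup$ pointwise min/max. Extended Iverson bracket $[\varphi](\sigma)=+\infty$ if $\sigma\models\varphi$, else $-\infty$. $f[x/\alpha]:=\lambda\sigma.f(\sigma[x\mapsto\alpha])$ for $\alpha\in\mathbb{V}$; $\inf_\alpha$ pointwise over $\alpha\in\mathbb{V}$; $[x\neq e[x/\alpha]](\sigma)=+\infty$ iff $\sigma(x)\neq\sigma[x\mapsto\alpha](e)$, else $-\infty$. Strongest liberal post $\mathsf{slp}[\![C]\!]:\mathbb{A}\to\mathbb{A}$: $\mathsf{slp}[\![\mathtt{skip}]\!](f)=f$; $\mathsf{slp}[\![x:=e]\!](f)=\inf_\alpha\,[x\neq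 e[x/\alpha]]\sqcup f[x/\alpha]$; $\mathsf{slp}[\![C_1;C_2]\!](f)=\mathsf{slp}[\![C_2]\!](\mathsf{slp}[\![C_1]\!](f))$; $\mathsf{slp}[\![\mathtt{if}(\varphi)\{C_1\}\mathtt{else}\{C_2\}]\!](f)=\mathsf{slp}[\![C_1]\!]([\neg\varphi]\sqcup f)\sqcap\mathsf{slp}[\![C_2]\!]([\varphi]\sqcup f)$; $\mathsf{slp}[\![\{C_1\}\square\{C_2\}]\!](f)=\mathsf{slp}[\![C_1]\!](f)\sqcap\mathsf{slp}[\![C_2]\!](f)$; $\mathsf{slp}[\![\mathtt{while}(\varphi)\{C\}]\!](f)=[\varphi]\sqcup\big(\mathrm{gfp}\,X.\,f\sqcap\mathsf{slp}[\![C]\!]([\neg\varphi]\sqcup X)\big)$, gfp in $(\mathbb{A},\preceq)$. -}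

module Defs where

open import Data.Bool using (Bool; true; false; if_then_else_)
open import Data.Empty using (⊥)
open import Data.Product using (Σ; proj₁)
open import Relation.Nullary using (¬_; does)
open import Relation.Binary.PropositionalEquality using (_≡_; _≢_)
open import Relation.Binary.Definitions using (DecidableEquality)

record CompleteLattice : Set₁ where
  field
    Carrier   : Set
    _≤_       : Carrier → Carrier → Set
    ≤-refl    : ∀ {x} → x ≤ x
    ≤-trans   : ∀ {x y z} → x ≤ y → y ≤ z → x ≤ z
    ≤-antisym : ∀ {x y} → x ≤ y → y ≤ x → x ≡ y
    ⋁         : {I : Set} → (I → Carrier) → Carrier
    ⋁-upper   : ∀ {I : Set} (f : I → Carrier) (i : I) → f i ≤ ⋁ f
    ⋁-least   : ∀ {I : Set} (f : I → Carrier) (x : Carrier) → (∀ i → f i ≤ x) → ⋁ f ≤ x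
    ⋀         : {I : Set} → (I → Carrier) → Carrier
    ⋀-lower   : ∀ {I : Set} (f : I → Carrier) (i : I) → ⋀ f ≤ f i
    ⋀-greatest : ∀ {I : Set} (f : I → Carrier) (x : Carrier) → (∀ i → x ≤ f i) → x ≤ ⋀ f

  +∞ : Carrier
  +∞ = ⋀ {⊥} (λ ())

  -∞ : Carrier
  -∞ = ⋁ {⊥} (λ ())

  _⊓_ : Carrier → Carrier → Carrier
  x ⊓ y = ⋀ {Bool} (λ b → if b then x else y)

  _⊔_ : Carrier → Carrier → Carrier
  x ⊔ y = ⋁ {Bool} (λ b → if b then x else y)

  -- extended Iverson bracket of a proposition: +∞ if P holds, -∞ otherwise
  -- (the supremum of the family constantly +∞ indexed by proofs of P)
  [_] : Set → Carrier
  [ P ] = ⋁ {P} (λ _ → +∞)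

module nGCL (Var V : Set) (_≟_ : DecidableEquality Var) where

  State : Set
  State = Var → V

  _[_↦_] : State → Var → V → State
  (σ [ x ↦ v ]) y = if does (y ≟ x) then v else σ y

  Expr : Set
  Expr = State → V

  Guard : Set₁
  Guard = State → Set

  data Prog : Set₁ where
    skip   : Prog
    _:=_   : Var → Expr → Prog
    _⨾_    : Prog → Prog → Prog
    ifte   : Guard → Prog → Prog → Prog
    _□_    : Prog → Prog → Prog
    while  : Guard → Prog → Prog

  module Semantics (L : CompleteLattice) where
    open CompleteLattice L

    𝔸 : Set
    𝔸 = State → Carrier

    -- greatest fixed point (Knaster–Tarski): supremum of all post-fixed points
    gfp : (𝔸 → 𝔸) → 𝔸
    gfp F σ = ⋁ {Σ 𝔸 (λ X → ∀ τ → X τ ≤ F X τ)} (λ p → proj₁ p σ)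

    slp : Prog → 𝔸 → 𝔸
    slp skip f = f
    slp (x := e) f σ =
      ⋀ {V} (λ α → [ σ x ≢ e (σ [ x ↦ α ]) ] ⊔ f (σ [ x ↦ α ]))
    slp (C₁ ⨾ C₂) f = slp C₂ (slp C₁ f)
    slp (ifte φ C₁ C₂) f σ =
      slp C₁ (λ τ → [ ¬ φ τ ] ⊔ f τ) σ ⊓ slp C₂ (λ τ → [ φ τ ] ⊔ f τ) σ
    slp (C₁ □ C₂) f σ = slp C₁ f σ ⊓ slp C₂ f σ
    slp (while φ C) f σ =
      [ φ σ ] ⊔ gfp (λ X τ → f τ ⊓ slp C (λ ρ → [ ¬ φ ρ ] ⊔ X ρ) τ) σ

-- By induction on the program, slp maps the top quantity to the top quantity:
-- meets and joins with a top argument stay top, and for a loop the constant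
-- +∞ is itself a post-fixed point of the loop functional, so the gfp is +∞.
module Submission where

open import Data.Bool using (true; false; if_then_else_)
open import Data.Empty using (⊥)
open import Data.Product using (_,_)
open import Relation.Nullary using (¬_)
open import Relation.Binary.PropositionalEquality using (_≡_; _≢_)
open import Relation.Binary.Definitions using (DecidableEquality)

open import Defs

module LatticeProperties (L : CompleteLattice) where
  open CompleteLattice L

  x≤+∞ : ∀ x → x ≤ +∞
  x≤+∞ x = ⋀-greatest {⊥} (λ ()) x (λ ())

  y≤x⊔y : ∀ x y → y ≤ (x ⊔ y)
  y≤x⊔y x y = ⋁-upper (λ b → if b then x else y) false

  ⊓-greatest : ∀ {z x y} → z ≤ x → z ≤ y → z ≤ (x ⊓ y)
  ⊓-greatest {z} z≤x z≤y = ⋀-greatest _ z λ { true → z≤x ; false → z≤y }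

module CoStrictness (L : CompleteLattice) (Var V : Set) (_≟_ : DecidableEquality Var) where
  open CompleteLattice L
  open LatticeProperties L
  open nGCL Var V _≟_
  open Semantics L

  IsTop : 𝔸 → Set
  IsTop f = ∀ σ → +∞ ≤ f σ

  ⊔-isTopʳ : ∀ (g f : 𝔸) → IsTop f → IsTop (λ σ → g σ ⊔ f σ)
  ⊔-isTopʳ g f top σ = ≤-trans (top σ) (y≤x⊔y (g σ) (f σ))

  ⊤ : 𝔸
  ⊤ _ = +∞

  gfp-isTop : ∀ (F : 𝔸 → 𝔸) → IsTop (F ⊤) → IsTop (gfp F)
  gfp-isTop F ⊤-postFixed σ = ⋁-upper _ (⊤ , ⊤-postFixed)

  slp-isTop : ∀ C f → IsTop f → IsTop (slp C f)
  slp-isTop skip f top = top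
  slp-isTop (x := e) f top σ =
    ⋀-greatest _ +∞ λ α → ⊔-isTopʳ (λ τ → [ σ x ≢ e τ ]) f top (σ [ x ↦ α ])
  slp-isTop (C₁ ⨾ C₂) f top = slp-isTop C₂ _ (slp-isTop C₁ f top)
  slp-isTop (ifte φ C₁ C₂) f top σ =
    ⊓-greatest (slp-isTop C₁ _ (⊔-isTopʳ _ f top) σ)
               (slp-isTop C₂ _ (⊔-isTopʳ _ f top) σ)
  slp-isTop (C₁ □ C₂) f top σ =
    ⊓-greatest (slp-isTop C₁ f top σ) (slp-isTop C₂ f top σ)
  slp-isTop (while φ C) f top σ =
    ⊔-isTopʳ (λ τ → [ φ τ ]) _ (gfp-isTop _ ⊤-postFixed) σ
    where
    ⊤-postFixed : IsTop (λ τ → f τ ⊓ slp C (λ ρ → [ ¬ φ ρ ] ⊔ +∞) τ)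
    ⊤-postFixed τ =
      ⊓-greatest (top τ) (slp-isTop C _ (⊔-isTopʳ (λ ρ → [ ¬ φ ρ ]) ⊤ (λ _ → ≤-refl)) τ)

mainTheorem14 : (L : CompleteLattice) (Var V : Set) (_≟_ : DecidableEquality Var)
    → (C : nGCL.Prog Var V _≟_) (σ : nGCL.State Var V _≟_)
    → nGCL.Semantics.slp Var V _≟_ L C (λ _ → CompleteLattice.+∞ L) σ ≡ CompleteLattice.+∞ L
mainTheorem14 L Var V _≟_ C σ =
  ≤-antisym (x≤+∞ _) (slp-isTop C ⊤ (λ _ → ≤-refl) σ)
  where
  open CompleteLattice L
  open LatticeProperties L
  open CoStrictness L Var V _≟_
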